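{- Let $n$ and $a \ge 1$ be integers and $1 < k_1 < k_2 < \cdots < k_a < n$. Let $G = T(n,\{k_1,\ldots,k_a\})$ and $t(v_i) = t(G, v_i, v_n)$, and set $k_0 = 1$. Then for $0 \le s \le a-1$ and $k_s \le i \le k_{s+1}$, \[ t(v_i) = n^2 - i^2 + 2(a-1)n - 2(s-1)i - 2\sum_{j=s+1}^{a} k_j, \] and for $k_a \le i \le n-1$, \[ t(v_i) = n^2 - i^2 + 2(a-1)(n-i). \]
   Context: $T(n,\{k_1,\ldots,k_a\})$ is the tree consisting of a path (spine) $v_1 v_2 \cdots v_n$ together with leaves $u_{k_1},\ldots,u_{k_a}$, where $u_{k_i}$ is adjacent only to $v_{k_i}$. $t(G,v,u)$ denotes the expected number of steps until a simple random walk on $G$ started at $v$ (moving each step to a uniformly random neighbor) first reaches $u$. -}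

module Defs where

open import Data.Nat as ℕ using (ℕ; zero; suc; _≡ᵇ_)
open import Data.Integer as ℤ using (ℤ; +_)
open import Data.Rational as ℚ using (ℚ; 0ℚ; 1ℚ)
open import Data.Fin as Fin using (Fin; toℕ)
open import Data.Sum using (_⊎_; inj₁; inj₂)
import Data.Sum.Properties as SumP
open import Data.Bool using (Bool; true; false; if_then_else_; _∨_)
open import Data.List as List using (List; []; _∷_; _++_; filter; length; map; allFin; drop)
open import Data.Vec as Vec using (Vec; lookup; toList)
open import Relation.Nullary using (does)
open import Relation.Binary.PropositionalEquality using (_≡_)
open import Relation.Binary.Definitions using (DecidableEquality)
open import Data.Product using (Σ; _×_; ∃-syntax)
open import Data.Nat.ListAction using () renaming (sum to sumℕ)

record Graph : Set₁ where
  field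
    V        : Set
    _≟V_     : DecidableEquality V
    vertices : List V          -- enumeration of all vertices (each once)
    adj      : V → V → Bool    -- symmetric adjacency

  nbrs : V → List V
  nbrs x = filter (λ y → Data.Bool._≟_ (adj x y) true) vertices

  deg : V → ℕ
  deg x = length (nbrs x)

open Graph public

-- 1 / d as a rational (0 for d = 0, never used with nonzero weight)
inv : ℕ → ℚ
inv zero    = 0ℚ
inv (suc d) = (+ 1) ℚ./ suc d

sumℚ : List ℚ → ℚ
sumℚ = List.foldr ℚ._+_ 0ℚ

-- survive G v u k w = P(X_k = w and X_j ≠ u for all j ≤ k), for the simple
-- random walk (X_j) on G started at X_0 = v.
survive : (G : Graph) → V G → V G → ℕ → V G → ℚ
survive G v u zero w =
  if does (_≟V_ G w v) then (if does (_≟V_ G v u) then 0ℚ else 1ℚ) else 0ℚ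
survive G v u (suc k) w =
  if does (_≟V_ G w u) then 0ℚ
  else sumℚ (map (λ x → survive G v u k x ℚ.* inv (deg G x)) (nbrs G w))

tailProb : (G : Graph) → V G → V G → ℕ → ℚ
tailProb G v u k = sumℚ (map (survive G v u k) (vertices G))

partialSum : (G : Graph) → V G → V G → ℕ → ℚ
partialSum G v u zero    = 0ℚ
partialSum G v u (suc m) = partialSum G v u m ℚ.+ tailProb G v u m

-- t(G,v,u) = E[T_u] = Σ_{k ≥ 0} P(T_u > k) equals the rational number t:
-- the partial sums converge to t.
HittingTime≡ : (G : Graph) → V G → V G → ℚ → Set
HittingTime≡ G v u t =
  ∀ (ε : ℚ) → 0ℚ ℚ.< ε → ∃[ N ] ∀ m → N ℕ.≤ m → ℚ.∣ partialSum G v u m ℚ.- t ∣ ℚ.< ε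

-- The tree T(n, {k_1,...,k_a})
-- Spine vertex v_i (1 ≤ i ≤ n) is inj₁ i' with toℕ i' + 1 = i;
-- leaf u_{k_j} (1 ≤ j ≤ a) is inj₂ j' with toℕ j' + 1 = j, where
-- ks is the vector (k_1, ..., k_a).

treeAdj : ∀ {n a} → Vec ℕ a → Fin n ⊎ Fin a → Fin n ⊎ Fin a → Bool
treeAdj ks (inj₁ i) (inj₁ j) = (suc (toℕ i) ≡ᵇ toℕ j) ∨ (suc (toℕ j) ≡ᵇ toℕ i)
treeAdj ks (inj₁ i) (inj₂ j) = suc (toℕ i) ≡ᵇ lookup ks j
treeAdj ks (inj₂ j) (inj₁ i) = suc (toℕ i) ≡ᵇ lookup ks j
treeAdj ks (inj₂ i) (inj₂ j) = false

T : (n a : ℕ) → Vec ℕ a → Graph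
T n a ks = record
  { V        = Fin n ⊎ Fin a
  ; _≟V_     = SumP.≡-dec Fin._≟_ Fin._≟_
  ; vertices = map inj₁ (allFin n) ++ map inj₂ (allFin a)
  ; adj      = treeAdj ks
  }

lookupℕ : List ℕ → ℕ → ℕ
lookupℕ []       _       = 0
lookupℕ (x ∷ xs) zero    = x
lookupℕ (x ∷ xs) (suc s) = lookupℕ xs s

kAt : ∀ {a} → Vec ℕ a → ℕ → ℕ
kAt ks zero    = 1
kAt ks (suc s) = lookupℕ (toList ks) s

sumFrom : ∀ {a} → Vec ℕ a → ℕ → ℕ
sumFrom ks s = sumℕ (drop s (toList ks))

toℚ : ℤ → ℚ
toℚ z = z ℚ./ 1

formula₁ : ∀ {a} → ℕ → Vec ℕ a → ℕ → ℕ → ℚ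
formula₁ {a} n ks s i = toℚ
  ( + (n ℕ.* n) ℤ.- + (i ℕ.* i)
  ℤ.+ (+ 2) ℤ.* (+ a ℤ.- + 1) ℤ.* + n
  ℤ.- (+ 2) ℤ.* (+ s ℤ.- + 1) ℤ.* + i
  ℤ.- (+ 2) ℤ.* + (sumFrom ks s) )

formula₂ : ℕ → ℕ → ℕ → ℚ
formula₂ a n i = toℚ
  ( + (n ℕ.* n) ℤ.- + (i ℕ.* i)
  ℤ.+ (+ 2) ℤ.* (+ a ℤ.- + 1) ℤ.* (+ n ℤ.- + i) )

{-# OPTIONS --safe #-}
module Submission where

-- Call h : V → ℕ a hitting potential for the target u if h u = 0 and, at every other
-- vertex, h is one more than the average of h over the neighbours. For the walk from v let
-- R k = E[h(X_k); T > k], T the hitting time of u. First-step analysis gives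
-- R (k+1) + P(T > k) = R k and R 0 = h v, so the m-th partial sum of Σ_k P(T > k) is
-- h v − R m. As R is non-increasing and R k ≤ (Σ h)·P(T > k), we get m·R m ≤ (Σ h)·h v,
-- hence R m → 0 and E[T] = h v.
-- On T(n, K) the potential is h(v_i) = (n − i)(n + i − 2) + 2 Σ_j (n − max(i, k_j)). The
-- first term is the hitting time on the bare path; a leaf at v_k adds one edge behind every
-- v_m with m ≥ k, so 2 to the expected time of each step v_m → v_(m+1), and hence
-- 2(n − max(i, k)) to the time from v_i. Splitting the leaves into those left and right of
-- v_i gives the formulas of the paper.

open import Defs
open import Algebra.Bundles using (CommutativeSemiring; CommutativeRing)
open import Data.Bool as Bool using (Bool; true; false; if_then_else_; _∨_)
import Data.Bool.Properties as BoolP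
open import Data.Empty using (⊥)
open import Data.Fin as Fin using (Fin; toℕ)
import Data.Fin.Properties as FinP
open import Data.Integer as ℤ using (+_; +[1+_]; -[1+_])
import Data.Integer.Properties as ℤP
import Data.Integer.Solver as ℤSolver
open import Data.List as List using (List; []; _∷_; _++_; map; filter; foldr; length; allFin)
import Data.List.Properties as ListP
open import Data.List.Membership.Propositional using (_∈_)
open import Data.List.Membership.Propositional.Properties using (∈-allFin; ∈-map⁺; ∈-map⁻; ∈-++⁺ˡ)
open import Data.List.Relation.Unary.All as All using (All)
open import Data.List.Relation.Unary.Any using (here; there)
open import Data.List.Relation.Unary.Unique.Propositional using (Unique; _∷_)
import Data.List.Relation.Unary.Unique.Propositional.Properties as Unique
open import Data.Nat as ℕ using (ℕ; zero; suc; NonZero; _≤_; _<_; _∸_)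
open import Data.Nat.ListAction using () renaming (sum to sumℕ)
import Data.Nat.Properties as ℕP
import Data.Nat.Coprimality as Coprime
open import Data.Product using (∃-syntax; _,_; _×_; proj₁; proj₂)
open import Data.Rational as ℚ using (ℚ; 0ℚ; 1ℚ; mkℚ)
import Data.Rational.Properties as ℚP
import Data.Rational.Solver as ℚSolver
import Data.Rational.Unnormalised as ℚᵘ
import Data.Rational.Unnormalised.Properties as ℚᵘP
open import Data.Sum using (_⊎_; inj₁; inj₂)
import Data.Sum.Properties as SumP
open import Data.Vec using (Vec; []; _∷_; lookup; toList)
import Data.Vec.Properties as VecP
open import Function using (_∘_; id)
open import Relation.Binary.PropositionalEquality as ≡ using (_≡_; _≢_; ≢-sym)
open import Relation.Nullary using (¬_; contradiction; yes; no)

module FiniteSum {c ℓ} (R : CommutativeSemiring c ℓ) where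

  open CommutativeSemiring R
  open import Relation.Binary.Reasoning.Setoid setoid

  ∑ : {A : Set} → (A → Carrier) → List A → Carrier
  ∑ f xs = foldr _+_ 0# (map f xs)

  module _ {A : Set} where

    ∑-cong-∈ : ∀ {f g : A → Carrier} xs → (∀ {x} → x ∈ xs → f x ≈ g x) → ∑ f xs ≈ ∑ g xs
    ∑-cong-∈ []       f≈g = refl
    ∑-cong-∈ (x ∷ xs) f≈g = +-cong (f≈g (here ≡.refl)) (∑-cong-∈ xs (f≈g ∘ there))

    ∑-cong : ∀ {f g : A → Carrier} xs → (∀ x → f x ≈ g x) → ∑ f xs ≈ ∑ g xs
    ∑-cong xs f≈g = ∑-cong-∈ xs (λ {x} _ → f≈g x)

    ∑-zero : ∀ {f : A → Carrier} xs → (∀ {x} → x ∈ xs → f x ≈ 0#) → ∑ f xs ≈ 0#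
    ∑-zero []       f≈0 = refl
    ∑-zero (x ∷ xs) f≈0 = trans (+-cong (f≈0 (here ≡.refl)) (∑-zero xs (f≈0 ∘ there))) (+-identityˡ 0#)

    ∑-distrib-+ : ∀ (f g : A → Carrier) xs → ∑ (λ x → f x + g x) xs ≈ ∑ f xs + ∑ g xs
    ∑-distrib-+ f g []       = sym (+-identityˡ 0#)
    ∑-distrib-+ f g (x ∷ xs) = begin
      (f x + g x) + ∑ (λ y → f y + g y) xs ≈⟨ +-congˡ (∑-distrib-+ f g xs) ⟩
      (f x + g x) + (∑ f xs + ∑ g xs)      ≈⟨ +-assoc (f x) (g x) _ ⟩
      f x + (g x + (∑ f xs + ∑ g xs))      ≈⟨ +-congˡ (x+[y+z]≈y+[x+z] (g x) (∑ f xs) (∑ g xs)) ⟩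
      f x + (∑ f xs + (g x + ∑ g xs))      ≈⟨ sym (+-assoc (f x) (∑ f xs) _) ⟩
      (f x + ∑ f xs) + (g x + ∑ g xs)      ∎
      where
      x+[y+z]≈y+[x+z] : ∀ a b d → a + (b + d) ≈ b + (a + d)
      x+[y+z]≈y+[x+z] a b d = trans (sym (+-assoc a b d)) (trans (+-congʳ (+-comm a b)) (+-assoc b a d))

    *-distribˡ-∑ : ∀ y (f : A → Carrier) xs → y * ∑ f xs ≈ ∑ (λ x → y * f x) xs
    *-distribˡ-∑ y f []       = zeroʳ y
    *-distribˡ-∑ y f (x ∷ xs) = trans (distribˡ y (f x) (∑ f xs)) (+-congˡ (*-distribˡ-∑ y f xs))

    *-distribʳ-∑ : ∀ y (f : A → Carrier) xs → ∑ f xs * y ≈ ∑ (λ x → f x * y) xs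
    *-distribʳ-∑ y f xs = trans (*-comm (∑ f xs) y) (trans (*-distribˡ-∑ y f xs) (∑-cong xs (λ x → *-comm y (f x))))

    ∑-++ : ∀ (f : A → Carrier) xs ys → ∑ f (xs ++ ys) ≈ ∑ f xs + ∑ f ys
    ∑-++ f []       ys = sym (+-identityˡ (∑ f ys))
    ∑-++ f (x ∷ xs) ys = trans (+-congˡ (∑-++ f xs ys)) (sym (+-assoc (f x) (∑ f xs) (∑ f ys)))

    ∑-map : ∀ {B : Set} (f : B → Carrier) (g : A → B) xs → ∑ f (map g xs) ≡ ∑ (f ∘ g) xs
    ∑-map f g xs = ≡.cong (foldr _+_ 0#) (≡.sym (ListP.map-∘ xs))

    ∑-filter : ∀ (b : A → Bool) f xs →
               ∑ f (filter (λ x → b x Bool.≟ true) xs) ≈ ∑ (λ x → if b x then f x else 0#) xs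
    ∑-filter b f []       = refl
    ∑-filter b f (x ∷ xs) with b x
    ... | true  = +-congˡ (∑-filter b f xs)
    ... | false = trans (∑-filter b f xs) (sym (+-identityˡ _))

    ∑-pick : ∀ {f : A → Carrier} {xs y} → Unique xs → y ∈ xs → (∀ x → x ≢ y → f x ≈ 0#) → ∑ f xs ≈ f y
    ∑-pick {xs = y ∷ xs} (y∉xs ∷ _) (here ≡.refl) f≈0 =
      trans (+-congˡ (∑-zero xs (λ x∈xs → f≈0 _ (≢-sym (All.lookup y∉xs x∈xs))))) (+-identityʳ _)
    ∑-pick {xs = x ∷ xs} (x∉xs ∷ uniq) (there y∈xs) f≈0 =
      trans (+-congʳ (f≈0 x (All.lookup x∉xs y∈xs))) (trans (+-identityˡ _) (∑-pick uniq y∈xs f≈0))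

  ∑-comm : ∀ {A B : Set} (f : A → B → Carrier) xs ys →
           ∑ (λ x → ∑ (f x) ys) xs ≈ ∑ (λ y → ∑ (λ x → f x y) xs) ys
  ∑-comm f []       ys = sym (∑-zero ys (λ _ → refl))
  ∑-comm f (x ∷ xs) ys = trans (+-congˡ (∑-comm f xs ys)) (sym (∑-distrib-+ (f x) _ ys))

module ℕ∑ = FiniteSum ℕP.+-*-commutativeSemiring
module ℚ∑ = FiniteSum (CommutativeRing.commutativeSemiring ℚP.+-*-commutativeRing)

ℕtoℚ : ℕ → ℚ
ℕtoℚ m = toℚ (+ m)

ℕtoℚ≡mkℚ : ∀ m → ℕtoℚ m ≡ mkℚ (+ m) 0 (Coprime.sym (Coprime.1-coprimeTo m))
ℕtoℚ≡mkℚ m = ℚP.normalize-coprime (Coprime.sym (Coprime.1-coprimeTo m))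

ℕtoℚ-homo-+ : ∀ m n → ℕtoℚ (m ℕ.+ n) ≡ ℕtoℚ m ℚ.+ ℕtoℚ n
ℕtoℚ-homo-+ m n = ≡.trans (≡.cong (ℚ._/ 1) +m+n≡) (≡.sym (≡.cong₂ ℚ._+_ (ℕtoℚ≡mkℚ m) (ℕtoℚ≡mkℚ n)))
  where
  +m+n≡ : + (m ℕ.+ n) ≡ + m ℤ.* + 1 ℤ.+ + n ℤ.* + 1
  +m+n≡ = ≡.trans (ℤP.pos-+ m n) (≡.sym (≡.cong₂ ℤ._+_ (ℤP.*-identityʳ (+ m)) (ℤP.*-identityʳ (+ n))))

ℕtoℚ-homo-* : ∀ m n → ℕtoℚ (m ℕ.* n) ≡ ℕtoℚ m ℚ.* ℕtoℚ n
ℕtoℚ-homo-* m n = ≡.trans (≡.cong (ℚ._/ 1) (ℤP.pos-* m n)) (≡.sym (≡.cong₂ ℚ._*_ (ℕtoℚ≡mkℚ m) (ℕtoℚ≡mkℚ n)))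

ℕtoℚ-mono-≤ : ∀ {m n} → m ℕ.≤ n → ℕtoℚ m ℚ.≤ ℕtoℚ n
ℕtoℚ-mono-≤ {m} {n} m≤n rewrite ℕtoℚ≡mkℚ m | ℕtoℚ≡mkℚ n =
  ℚ.*≤* (ℤP.*-monoʳ-≤-nonNeg (+ 1) (ℤ.+≤+ m≤n))

ℕtoℚ-nonNeg : ∀ m → 0ℚ ℚ.≤ ℕtoℚ m
ℕtoℚ-nonNeg m = ℕtoℚ-mono-≤ {0} {m} ℕ.z≤n

ℕtoℚ-homo-∑ : ∀ {A : Set} (f : A → ℕ) xs → ℚ∑.∑ (ℕtoℚ ∘ f) xs ≡ ℕtoℚ (ℕ∑.∑ f xs)
ℕtoℚ-homo-∑ f []       = ≡.refl
ℕtoℚ-homo-∑ f (x ∷ xs) = ≡.trans (≡.cong (ℕtoℚ (f x) ℚ.+_) (ℕtoℚ-homo-∑ f xs)) (≡.sym (ℕtoℚ-homo-+ (f x) _))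

inv-nonNeg : ∀ d → 0ℚ ℚ.≤ inv d
inv-nonNeg zero    = ℚP.≤-refl
inv-nonNeg (suc d) = ℚP.nonNegative⁻¹ (inv (suc d)) {{ℚP.normalize-nonNeg 1 (suc d)}}

inv-inverseˡ : ∀ d .{{_ : NonZero d}} → inv d ℚ.* ℕtoℚ d ≡ 1ℚ
inv-inverseˡ (suc d) =
  ≡.trans (≡.cong₂ ℚ._*_ (ℚP.normalize-coprime (Coprime.1-coprimeTo (suc d))) (ℕtoℚ≡mkℚ (suc d)))
          (ℚP.*-inverseˡ (mkℚ (+ suc d) 0 (Coprime.sym (Coprime.1-coprimeTo (suc d)))))

archimedean : ∀ M ε → 0ℚ ℚ.< ε → ∃[ N ] ℕtoℚ M ℚ.< ℕtoℚ N ℚ.* ε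
archimedean M ε@(mkℚ +[1+ e ] d _) _ = N , ℚP.toℚᵘ-cancel-< (ℚᵘP.<-respʳ-≃ (ℚᵘP.≃-sym (ℚP.toℚᵘ-homo-* (ℕtoℚ N) ε)) M<Nε)
  where
  N = suc (M ℕ.* suc d)
  M[1+d]<N[1+e] : M ℕ.* (suc d ℕ.+ 0) ℕ.< N ℕ.* suc e ℕ.* 1
  M[1+d]<N[1+e] rewrite ℕP.+-identityʳ (suc d) | ℕP.*-identityʳ (N ℕ.* suc e) =
    ℕP.<-≤-trans (ℕP.n<1+n _) (ℕP.m≤m*n N (suc e))
  M<Nε : ℚ.toℚᵘ (ℕtoℚ M) ℚᵘ.< ℚ.toℚᵘ (ℕtoℚ N) ℚᵘ.* ℚ.toℚᵘ ε
  M<Nε rewrite ℕtoℚ≡mkℚ M | ℕtoℚ≡mkℚ N =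
    ℚᵘ.*<* (≡.subst₂ ℤ._<_ (ℤP.pos-* M (suc d ℕ.+ 0))
                          (≡.trans (ℤP.pos-* (N ℕ.* suc e) 1) (≡.cong (ℤ._* + 1) (ℤP.pos-* N (suc e))))
                          (ℤ.+<+ M[1+d]<N[1+e]))
archimedean M (mkℚ (+ 0)    _ _) (ℚ.*<* (ℤ.+<+ ()))
archimedean M (mkℚ -[1+ _ ] _ _) (ℚ.*<* ())

module _ {A : Set} where

  ℕ∑-const : ∀ c (xs : List A) → ℕ∑.∑ (λ _ → c) xs ≡ length xs ℕ.* c
  ℕ∑-const c []       = ≡.refl
  ℕ∑-const c (x ∷ xs) = ≡.cong (c ℕ.+_) (ℕ∑-const c xs)

  ∈⇒≤∑ : ∀ (f : A → ℕ) {x xs} → x ∈ xs → f x ℕ.≤ ℕ∑.∑ f xs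
  ∈⇒≤∑ f {xs = y ∷ ys} (here ≡.refl) = ℕP.m≤m+n (f y) (ℕ∑.∑ f ys)
  ∈⇒≤∑ f {xs = y ∷ ys} (there x∈ys)  = ℕP.≤-trans (∈⇒≤∑ f x∈ys) (ℕP.m≤n+m _ (f y))

  ℚ∑-mono-∈ : ∀ {f g : A → ℚ} xs → (∀ {x} → x ∈ xs → f x ℚ.≤ g x) → ℚ∑.∑ f xs ℚ.≤ ℚ∑.∑ g xs
  ℚ∑-mono-∈ []       f≤g = ℚP.≤-refl
  ℚ∑-mono-∈ (x ∷ xs) f≤g = ℚP.+-mono-≤ (f≤g (here ≡.refl)) (ℚ∑-mono-∈ xs (f≤g ∘ there))

  ℚ∑-nonNeg : ∀ {f : A → ℚ} xs → (∀ x → 0ℚ ℚ.≤ f x) → 0ℚ ℚ.≤ ℚ∑.∑ f xs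
  ℚ∑-nonNeg xs 0≤f = ℚP.≤-trans (ℚP.≤-reflexive (≡.sym (ℚ∑.∑-zero xs (λ _ → ≡.refl))))
                                (ℚ∑-mono-∈ xs (λ {x} _ → 0≤f x))

*-nonNeg : ∀ {p q} → 0ℚ ℚ.≤ p → 0ℚ ℚ.≤ q → 0ℚ ℚ.≤ p ℚ.* q
*-nonNeg {p} {q} 0≤p 0≤q =
  ℚP.nonNegative⁻¹ _ {{ℚP.nonNeg*nonNeg⇒nonNeg p {{ℚ.nonNegative 0≤p}} q {{ℚ.nonNegative 0≤q}}}}

p≤p+q : ∀ {p q} → 0ℚ ℚ.≤ q → p ℚ.≤ p ℚ.+ q
p≤p+q {p} 0≤q = ℚP.≤-trans (ℚP.≤-reflexive (≡.sym (ℚP.+-identityʳ p))) (ℚP.+-monoʳ-≤ p 0≤q)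

deg≡∑1 : ∀ (G : Graph) x → deg G x ≡ ℕ∑.∑ (λ _ → 1) (nbrs G x)
deg≡∑1 G x = ≡.sym (≡.trans (ℕ∑-const 1 (nbrs G x)) (ℕP.*-identityʳ (deg G x)))

record HittingPotential (G : Graph) (u : V G) (h : V G → ℕ) : Set where
  field
    at-target   : h u ≡ 0
    deg-nonZero : ∀ {x} → x ≢ u → NonZero (deg G x)
    mean-value  : ∀ {x} → x ≢ u → deg G x ℕ.* h x ≡ deg G x ℕ.+ ℕ∑.∑ h (nbrs G x)

module _ (G : Graph) {u v : V G} {h : V G → ℕ}
         (adj-sym : ∀ x y → adj G x y ≡ adj G y x)
         (unique : Unique (vertices G)) (v∈ : v ∈ vertices G) (v≢u : v ≢ u)
         (potential : HittingPotential G u h)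
  where

  open HittingPotential potential
  open ℚSolver.+-*-Solver using (solve; _:=_; con; _:+_; _:*_; _:-_; :-_)
  open ℚ∑ using (∑)

  private
    Vs = vertices G
    P  = survive G v u
    ĥ : V G → ℚ
    ĥ = ℕtoℚ ∘ h

  flow : ℕ → V G → ℚ
  flow k x = P k x ℚ.* inv (deg G x)

  residual : ℕ → ℚ
  residual k = ∑ (λ x → P k x ℚ.* ĥ x) Vs

  survive-target : ∀ k → P k u ≡ 0ℚ
  survive-target zero with G ._≟V_ u v | G ._≟V_ v u
  ... | no _     | _      = ≡.refl
  ... | yes _    | yes _  = ≡.refl
  ... | yes u≡v  | no ¬v≡u = contradiction (≡.sym u≡v) ¬v≡u
  survive-target (suc k) with G ._≟V_ u u
  ... | yes _   = ≡.refl
  ... | no u≢u  = contradiction ≡.refl u≢u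

  survive-nonNeg : ∀ k x → 0ℚ ℚ.≤ P k x
  survive-nonNeg zero x with G ._≟V_ x v | G ._≟V_ v u
  ... | no _  | _     = ℚP.≤-refl
  ... | yes _ | yes _ = ℚP.≤-refl
  ... | yes _ | no _  = ℕtoℚ-nonNeg 1
  survive-nonNeg (suc k) x with G ._≟V_ x u
  ... | yes _ = ℚP.≤-refl
  ... | no _  = ℚ∑-nonNeg (nbrs G x) (λ y → *-nonNeg (survive-nonNeg k y) (inv-nonNeg (deg G y)))

  residual-0 : residual 0 ≡ ĥ v
  residual-0 = ≡.trans (ℚ∑.∑-pick unique v∈ vanish) at-start
    where
    vanish : ∀ x → x ≢ v → P 0 x ℚ.* ĥ x ≡ 0ℚ
    vanish x x≢v with G ._≟V_ x v
    ... | yes x≡v = contradiction x≡v x≢v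
    ... | no _    = ℚP.*-zeroˡ (ĥ x)
    at-start : P 0 v ℚ.* ĥ v ≡ ĥ v
    at-start with G ._≟V_ v v | G ._≟V_ v u
    ... | no v≢v | _       = contradiction ≡.refl v≢v
    ... | yes _  | yes v≡u = contradiction v≡u v≢u
    ... | yes _  | no _    = ℚP.*-identityˡ (ĥ v)

  mean-valueℚ : ∀ {x} → x ≢ u → ℕtoℚ (deg G x) ℚ.* ĥ x ≡ ℕtoℚ (deg G x) ℚ.+ ∑ ĥ (nbrs G x)
  mean-valueℚ {x} x≢u = begin
    ℕtoℚ (deg G x) ℚ.* ĥ x                    ≡⟨ ℕtoℚ-homo-* (deg G x) (h x) ⟨
    ℕtoℚ (deg G x ℕ.* h x)                    ≡⟨ ≡.cong ℕtoℚ (mean-value x≢u) ⟩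
    ℕtoℚ (deg G x ℕ.+ ℕ∑.∑ h (nbrs G x))      ≡⟨ ℕtoℚ-homo-+ (deg G x) _ ⟩
    ℕtoℚ (deg G x) ℚ.+ ℕtoℚ (ℕ∑.∑ h (nbrs G x)) ≡⟨ ≡.cong (ℕtoℚ (deg G x) ℚ.+_) (ℕtoℚ-homo-∑ h (nbrs G x)) ⟨
    ℕtoℚ (deg G x) ℚ.+ ∑ ĥ (nbrs G x)          ∎
    where open ≡.≡-Reasoning

  flow-mean-value : ∀ k x → flow k x ℚ.* ∑ ĥ (nbrs G x) ℚ.+ P k x ≡ P k x ℚ.* ĥ x
  flow-mean-value k x with G ._≟V_ x u
  ... | yes ≡.refl rewrite survive-target k =
    solve 3 (λ i s e → con 0ℚ :* i :* s :+ con 0ℚ := con 0ℚ :* e) ≡.refl (inv (deg G u)) (∑ ĥ (nbrs G u)) (ĥ u)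
  ... | no x≢u = begin
    p ℚ.* i ℚ.* s ℚ.+ p              ≡⟨ ≡.cong (p ℚ.* i ℚ.* s ℚ.+_) (ℚP.*-identityʳ p) ⟨
    p ℚ.* i ℚ.* s ℚ.+ p ℚ.* 1ℚ        ≡⟨ ≡.cong (λ z → p ℚ.* i ℚ.* s ℚ.+ p ℚ.* z) i*d≡1 ⟨
    p ℚ.* i ℚ.* s ℚ.+ p ℚ.* (i ℚ.* d) ≡⟨ solve 4 (λ p i s d → p :* i :* s :+ p :* (i :* d) := p :* i :* (d :+ s)) ≡.refl p i s d ⟩
    p ℚ.* i ℚ.* (d ℚ.+ s)           ≡⟨ ≡.cong (p ℚ.* i ℚ.*_) (mean-valueℚ x≢u) ⟨
    p ℚ.* i ℚ.* (d ℚ.* ĥ x)          ≡⟨ solve 4 (λ p i d e → p :* i :* (d :* e) := p :* (i :* d) :* e) ≡.refl p i d (ĥ x) ⟩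
    p ℚ.* (i ℚ.* d) ℚ.* ĥ x          ≡⟨ ≡.cong (λ z → p ℚ.* z ℚ.* ĥ x) i*d≡1 ⟩
    p ℚ.* 1ℚ ℚ.* ĥ x                 ≡⟨ ≡.cong (ℚ._* ĥ x) (ℚP.*-identityʳ p) ⟩
    p ℚ.* ĥ x                        ∎
    where
    open ≡.≡-Reasoning
    instance _ = deg-nonZero x≢u
    p = P k x
    i = inv (deg G x)
    d = ℕtoℚ (deg G x)
    s = ∑ ĥ (nbrs G x)
    i*d≡1 : i ℚ.* d ≡ 1ℚ
    i*d≡1 = inv-inverseˡ (deg G x)

  survive-suc : ∀ k w → P (suc k) w ℚ.* ĥ w ≡ ∑ (flow k) (nbrs G w) ℚ.* ĥ w
  survive-suc k w with G ._≟V_ w u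
  ... | no _       = ≡.refl
  ... | yes ≡.refl rewrite at-target = ≡.trans (ℚP.*-zeroˡ 0ℚ) (≡.sym (ℚP.*-zeroʳ (∑ (flow k) (nbrs G u))))

  ∑-nbrs-*ʳ : ∀ w (g : V G → ℚ) c → ∑ g (nbrs G w) ℚ.* c ≡ ∑ (λ x → if adj G w x then g x ℚ.* c else 0ℚ) Vs
  ∑-nbrs-*ʳ w g c = ≡.trans (ℚ∑.*-distribʳ-∑ c g (nbrs G w)) (ℚ∑.∑-filter (adj G w) (λ x → g x ℚ.* c) Vs)

  ∑-nbrs-*ˡ : ∀ x (g : V G → ℚ) c → c ℚ.* ∑ g (nbrs G x) ≡ ∑ (λ w → if adj G x w then c ℚ.* g w else 0ℚ) Vs
  ∑-nbrs-*ˡ x g c = ≡.trans (ℚ∑.*-distribˡ-∑ c g (nbrs G x)) (ℚ∑.∑-filter (adj G x) (λ w → c ℚ.* g w) Vs)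

  residual-suc : ∀ k → residual (suc k) ≡ ∑ (λ x → flow k x ℚ.* ∑ ĥ (nbrs G x)) Vs
  residual-suc k = begin
    residual (suc k)
      ≡⟨ ℚ∑.∑-cong Vs (survive-suc k) ⟩
    ∑ (λ w → ∑ (flow k) (nbrs G w) ℚ.* ĥ w) Vs
      ≡⟨ ℚ∑.∑-cong Vs (λ w → ∑-nbrs-*ʳ w (flow k) (ĥ w)) ⟩
    ∑ (λ w → ∑ (λ x → if adj G w x then flow k x ℚ.* ĥ w else 0ℚ) Vs) Vs
      ≡⟨ ℚ∑.∑-comm (λ w x → if adj G w x then flow k x ℚ.* ĥ w else 0ℚ) Vs Vs ⟩
    ∑ (λ x → ∑ (λ w → if adj G w x then flow k x ℚ.* ĥ w else 0ℚ) Vs) Vs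
      ≡⟨ ℚ∑.∑-cong Vs (λ x → ℚ∑.∑-cong Vs (λ w → ≡.cong (if_then flow k x ℚ.* ĥ w else 0ℚ) (adj-sym w x))) ⟩
    ∑ (λ x → ∑ (λ w → if adj G x w then flow k x ℚ.* ĥ w else 0ℚ) Vs) Vs
      ≡⟨ ℚ∑.∑-cong Vs (λ x → ∑-nbrs-*ˡ x ĥ (flow k x)) ⟨
    ∑ (λ x → flow k x ℚ.* ∑ ĥ (nbrs G x)) Vs
      ∎
    where open ≡.≡-Reasoning

  residual-step : ∀ k → residual (suc k) ℚ.+ tailProb G v u k ≡ residual k
  residual-step k = begin
    residual (suc k) ℚ.+ tailProb G v u k
      ≡⟨ ≡.cong (ℚ._+ tailProb G v u k) (residual-suc k) ⟩
    ∑ (λ x → flow k x ℚ.* ∑ ĥ (nbrs G x)) Vs ℚ.+ ∑ (P k) Vs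
      ≡⟨ ℚ∑.∑-distrib-+ (λ x → flow k x ℚ.* ∑ ĥ (nbrs G x)) (P k) Vs ⟨
    ∑ (λ x → flow k x ℚ.* ∑ ĥ (nbrs G x) ℚ.+ P k x) Vs
      ≡⟨ ℚ∑.∑-cong Vs (flow-mean-value k) ⟩
    residual k
      ∎
    where open ≡.≡-Reasoning

  partialSum+residual : ∀ m → partialSum G v u m ℚ.+ residual m ≡ ĥ v
  partialSum+residual zero    = ≡.trans (ℚP.+-identityˡ (residual 0)) residual-0
  partialSum+residual (suc m) = begin
    (Sₘ ℚ.+ Tₘ) ℚ.+ residual (suc m)  ≡⟨ solve 3 (λ Sₘ Tₘ R → (Sₘ :+ Tₘ) :+ R := Sₘ :+ (R :+ Tₘ)) ≡.refl Sₘ Tₘ (residual (suc m)) ⟩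
    Sₘ ℚ.+ (residual (suc m) ℚ.+ Tₘ)  ≡⟨ ≡.cong (Sₘ ℚ.+_) (residual-step m) ⟩
    Sₘ ℚ.+ residual m                ≡⟨ partialSum+residual m ⟩
    ĥ v                             ∎
    where
    open ≡.≡-Reasoning
    Sₘ = partialSum G v u m
    Tₘ = tailProb G v u m

  residual-nonNeg : ∀ k → 0ℚ ℚ.≤ residual k
  residual-nonNeg k = ℚ∑-nonNeg Vs (λ x → *-nonNeg (survive-nonNeg k x) (ℕtoℚ-nonNeg (h x)))

  tailProb-nonNeg : ∀ k → 0ℚ ℚ.≤ tailProb G v u k
  tailProb-nonNeg k = ℚ∑-nonNeg Vs (survive-nonNeg k)

  residual-antitone : ∀ k → residual (suc k) ℚ.≤ residual k
  residual-antitone k = ℚP.≤-trans (p≤p+q (tailProb-nonNeg k)) (ℚP.≤-reflexive (residual-step k))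

  private
    H : ℚ
    H = ℕtoℚ (ℕ∑.∑ h Vs)

  residual≤tailProb*H : ∀ k → residual k ℚ.≤ tailProb G v u k ℚ.* H
  residual≤tailProb*H k = ℚP.≤-trans
    (ℚ∑-mono-∈ Vs (λ {x} x∈Vs → ℚP.*-monoˡ-≤-nonNeg (P k x) {{ℚ.nonNegative (survive-nonNeg k x)}}
                                                    (ℕtoℚ-mono-≤ (∈⇒≤∑ h x∈Vs))))
    (ℚP.≤-reflexive (≡.sym (ℚ∑.*-distribʳ-∑ H (P k) Vs)))

  residual-decay : ∀ m → ℕtoℚ m ℚ.* residual m ℚ.≤ H ℚ.* partialSum G v u m
  residual-decay zero    = ℚP.≤-reflexive (≡.trans (ℚP.*-zeroˡ (residual 0)) (≡.sym (ℚP.*-zeroʳ H)))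
  residual-decay (suc m) = begin
    ℕtoℚ (suc m) ℚ.* residual (suc m)              ≡⟨ ≡.cong (ℚ._* residual (suc m)) (ℕtoℚ-homo-+ 1 m) ⟩
    (1ℚ ℚ.+ ℕtoℚ m) ℚ.* residual (suc m)           ≡⟨ solve 2 (λ m R → (con 1ℚ :+ m) :* R := R :+ m :* R) ≡.refl (ℕtoℚ m) (residual (suc m)) ⟩
    residual (suc m) ℚ.+ ℕtoℚ m ℚ.* residual (suc m) ≤⟨ ℚP.+-mono-≤ (ℚP.≤-trans (residual-antitone m) (residual≤tailProb*H m))
                                                          (ℚP.*-monoˡ-≤-nonNeg (ℕtoℚ m) {{ℚ.nonNegative (ℕtoℚ-nonNeg m)}} (residual-antitone m)) ⟩
    Tₘ ℚ.* H ℚ.+ ℕtoℚ m ℚ.* residual m              ≤⟨ ℚP.+-monoʳ-≤ (Tₘ ℚ.* H) (residual-decay m) ⟩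
    Tₘ ℚ.* H ℚ.+ H ℚ.* Sₘ                            ≡⟨ solve 3 (λ Tₘ H Sₘ → Tₘ :* H :+ H :* Sₘ := H :* (Sₘ :+ Tₘ)) ≡.refl Tₘ H Sₘ ⟩
    H ℚ.* (Sₘ ℚ.+ Tₘ)                                ∎
    where
    open ℚP.≤-Reasoning
    Sₘ = partialSum G v u m
    Tₘ = tailProb G v u m

  residual-decay-bound : ∀ m → ℕtoℚ m ℚ.* residual m ℚ.≤ ℕtoℚ (ℕ∑.∑ h Vs ℕ.* h v)
  residual-decay-bound m = ℚP.≤-trans (residual-decay m) (ℚP.≤-trans
    (ℚP.*-monoˡ-≤-nonNeg H {{ℚ.nonNegative (ℕtoℚ-nonNeg (ℕ∑.∑ h Vs))}} S≤ĥv)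
    (ℚP.≤-reflexive (≡.sym (ℕtoℚ-homo-* (ℕ∑.∑ h Vs) (h v)))))
    where
    S≤ĥv : partialSum G v u m ℚ.≤ ĥ v
    S≤ĥv = ℚP.≤-trans (p≤p+q (residual-nonNeg m)) (ℚP.≤-reflexive (partialSum+residual m))

  hittingTime≡potential : HittingTime≡ G v u (ℕtoℚ (h v))
  hittingTime≡potential ε 0<ε with archimedean (ℕ∑.∑ h Vs ℕ.* h v) ε 0<ε
  ... | N , M<Nε = N , λ m N≤m → ℚP.≤-<-trans (ℚP.≤-reflexive (distance≡residual m)) (residual<ε m N≤m)
    where
    distance≡residual : ∀ m → ℚ.∣ partialSum G v u m ℚ.- ĥ v ∣ ≡ residual m
    distance≡residual m = begin
      ℚ.∣ Sₘ ℚ.- ĥ v ∣                 ≡⟨ ≡.cong (λ z → ℚ.∣ Sₘ ℚ.- z ∣) (partialSum+residual m) ⟨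
      ℚ.∣ Sₘ ℚ.- (Sₘ ℚ.+ residual m) ∣  ≡⟨ ≡.cong ℚ.∣_∣ (solve 2 (λ Sₘ R → Sₘ :- (Sₘ :+ R) := :- R) ≡.refl Sₘ (residual m)) ⟩
      ℚ.∣ ℚ.- residual m ∣            ≡⟨ ℚP.∣-p∣≡∣p∣ (residual m) ⟩
      ℚ.∣ residual m ∣                ≡⟨ ℚP.0≤p⇒∣p∣≡p (residual-nonNeg m) ⟩
      residual m                      ∎
      where
      open ≡.≡-Reasoning
      Sₘ = partialSum G v u m
    residual<ε : ∀ m → N ℕ.≤ m → residual m ℚ.< ε
    residual<ε m N≤m with residual m ℚP.<? ε
    ... | yes R<ε = R<ε
    ... | no R≮ε  = contradiction (ℚP.≤-<-trans Nε≤M M<Nε) (ℚP.<-irrefl ≡.refl)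
      where
      Nε≤M : ℕtoℚ N ℚ.* ε ℚ.≤ ℕtoℚ (ℕ∑.∑ h Vs ℕ.* h v)
      Nε≤M = ℚP.≤-trans (ℚP.*-monoʳ-≤-nonNeg ε {{ℚ.nonNegative (ℚP.<⇒≤ 0<ε)}} (ℕtoℚ-mono-≤ N≤m))
             (ℚP.≤-trans (ℚP.*-monoˡ-≤-nonNeg (ℕtoℚ m) {{ℚ.nonNegative (ℕtoℚ-nonNeg m)}} (ℚP.≮⇒≥ R≮ε))
                         (residual-decay-bound m))

mean-value-from-∑ : ∀ (G : Graph) (h : V G → ℕ) x →
  ℕ∑.∑ (λ _ → h x) (nbrs G x) ≡ ℕ∑.∑ (suc ∘ h) (nbrs G x) → deg G x ℕ.* h x ≡ deg G x ℕ.+ ℕ∑.∑ h (nbrs G x)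
mean-value-from-∑ G h x balance = begin
  deg G x ℕ.* h x                                 ≡⟨ ℕ∑-const (h x) (nbrs G x) ⟨
  ℕ∑.∑ (λ _ → h x) (nbrs G x)                     ≡⟨ balance ⟩
  ℕ∑.∑ (suc ∘ h) (nbrs G x)                       ≡⟨ ℕ∑.∑-distrib-+ (λ _ → 1) h (nbrs G x) ⟩
  ℕ∑.∑ (λ _ → 1) (nbrs G x) ℕ.+ ℕ∑.∑ h (nbrs G x) ≡⟨ ≡.cong (ℕ._+ ℕ∑.∑ h (nbrs G x)) (deg≡∑1 G x) ⟨
  deg G x ℕ.+ ℕ∑.∑ h (nbrs G x)                   ∎
  where open ≡.≡-Reasoning

pathPotential : ℕ → ℕ → ℕ
pathPotential n i = (n ℕ.∸ i) ℕ.* (n ℕ.+ i ℕ.∸ 2)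

leafDelay : ℕ → ℕ → ℕ → ℕ
leafDelay n i k = n ℕ.∸ (i ℕ.⊔ k)

module _ where
  open import Data.Nat using (_+_; _*_; _⊔_; _≡ᵇ_; s≤s; z≤n)
  open import Data.Nat.Solver using (module +-*-Solver)
  open +-*-Solver using (solve; _:=_; con; _:+_; _:*_)

  [1+m+n]∸m≡1+n : ∀ m n → suc (m + n) ∸ m ≡ suc n
  [1+m+n]∸m≡1+n m n = ≡.trans (≡.cong (_∸ m) (≡.sym (ℕP.+-suc m n))) (ℕP.m+n∸m≡n m (suc n))

  [2+m+n]∸m≡2+n : ∀ m n → suc (suc (m + n)) ∸ m ≡ suc (suc n)
  [2+m+n]∸m≡2+n m n = ≡.trans (≡.cong (λ k → suc k ∸ m) (≡.sym (ℕP.+-suc m n))) ([1+m+n]∸m≡1+n m (suc n))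

  pathPotential-last : ∀ n → pathPotential n n ≡ 0
  pathPotential-last n = ≡.cong (_* (n + n ∸ 2)) (ℕP.n∸n≡0 n)

  pathPotential-first : ∀ {n} → 2 ≤ n → pathPotential n 2 + 1 ≡ pathPotential n 1
  pathPotential-first {suc (suc r)} (s≤s (s≤s z≤n)) =
    solve 1 (λ r → r :* (r :+ con 2) :+ con 1 := (con 1 :+ r) :* (r :+ con 1)) ≡.refl r

  pathPotential-step : ∀ {n} i → suc (suc i) ≤ n →
    pathPotential n (suc (suc i)) + pathPotential n i + 2 ≡ 2 * pathPotential n (suc i)
  pathPotential-step i 2+i≤n with ℕP.m≤n⇒∃[o]m+o≡n 2+i≤n
  ... | r , ≡.refl rewrite ℕP.m+n∸m≡n i r | [1+m+n]∸m≡1+n i r | [2+m+n]∸m≡2+n i r =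
    solve 2 (λ i r → r :* (i :+ r :+ (con 2 :+ i)) :+ (con 2 :+ r) :* (i :+ r :+ i) :+ con 2
                 := con 2 :* ((con 1 :+ r) :* (i :+ r :+ (con 1 :+ i)))) ≡.refl i r

  leafDelay-last : ∀ n k → leafDelay n n k ≡ 0
  leafDelay-last n k = ℕP.m≤n⇒m∸n≡0 (ℕP.m≤m⊔n n k)

  ∸-affine : ∀ {n} i → suc (suc i) ≤ n → n ∸ suc (suc i) + (n ∸ i) ≡ 2 * (n ∸ suc i)
  ∸-affine {suc (suc n)} zero    _           = solve 1 (λ x → x :+ (con 2 :+ x) := con 2 :* (con 1 :+ x)) ≡.refl n
  ∸-affine {suc n}       (suc i) (s≤s 2+i≤n) = ∸-affine i 2+i≤n

  leafDelay-first : ∀ {n k} → 2 ≤ n → 1 ≤ k → leafDelay n 2 k + (if 1 ≡ᵇ k then 1 else 0) ≡ leafDelay n 1 k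
  leafDelay-first {suc (suc n)} {suc zero}    _ _ = ℕP.+-comm n 1
  leafDelay-first {suc zero}    {suc zero}    (s≤s ()) _
  leafDelay-first {n}           {suc (suc k)} _ _ = ℕP.+-identityʳ _

  leafDelay-step : ∀ {n} i k → suc (suc i) ≤ n →
    leafDelay n (suc (suc i)) k + leafDelay n i k + (if suc i ≡ᵇ k then 1 else 0) ≡ 2 * leafDelay n (suc i) k
  leafDelay-step {n} zero    zero 2≤n   = ≡.trans (ℕP.+-identityʳ _) (∸-affine zero 2≤n)
  leafDelay-step {n} (suc i) zero 2+i≤n = ≡.trans (ℕP.+-identityʳ _) (∸-affine (suc i) 2+i≤n)
  leafDelay-step {suc zero}    zero (suc zero) (s≤s ())
  leafDelay-step {suc (suc n)} zero (suc zero) _ = solve 1 (λ x → x :+ (con 1 :+ x) :+ con 1 := con 2 :* (con 1 :+ x)) ≡.refl n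
  leafDelay-step {n} zero (suc (suc k)) _ = solve 1 (λ x → x :+ x :+ con 0 := con 2 :* x) ≡.refl (n ∸ suc (suc k))
  leafDelay-step {suc n} (suc i) (suc k) (s≤s 2+i≤n) = leafDelay-step i k 2+i≤n

if-∨ : ∀ b₁ b₂ (x : ℕ) → (Bool.T b₁ → Bool.T b₂ → ⊥) →
       (if b₁ ∨ b₂ then x else 0) ≡ (if b₁ then x else 0) ℕ.+ (if b₂ then x else 0)
if-∨ true  true  x disjoint = contradiction _ (disjoint _)
if-∨ true  false x _        = ≡.sym (ℕP.+-identityʳ x)
if-∨ false b₂    x _        = ≡.refl

∑-allFin-pick : ∀ {m} (b : ℕ → Bool) (f : Fin m → ℕ) {c y} → c ℕ.< m →
                (∀ k → Bool.T (b k) → k ≡ c) → Bool.T (b c) → (∀ j → toℕ j ≡ c → f j ≡ y) →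
                ℕ∑.∑ (λ j → if b (toℕ j) then f j else 0) (allFin m) ≡ y
∑-allFin-pick {m} b f {c} {y} c<m only-c b-c f≡y =
  ≡.trans (ℕ∑.∑-pick (Unique.allFin⁺ m) (∈-allFin (Fin.fromℕ< c<m)) vanish) at-c
  where
  vanish : ∀ j → j ≢ Fin.fromℕ< c<m → (if b (toℕ j) then f j else 0) ≡ 0
  vanish j j≢c with b (toℕ j) in b-j
  ... | false = ≡.refl
  ... | true  = contradiction
    (FinP.toℕ-injective (≡.trans (only-c (toℕ j) (≡.subst Bool.T (≡.sym b-j) _)) (≡.sym (FinP.toℕ-fromℕ< c<m)))) j≢c
  ĉ = Fin.fromℕ< c<m
  at-c : (if b (toℕ ĉ) then f ĉ else 0) ≡ y
  at-c = ≡.trans (≡.cong (λ k → if b k then f ĉ else 0) (FinP.toℕ-fromℕ< c<m))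
                 (≡.trans (if-T b-c) (f≡y ĉ (FinP.toℕ-fromℕ< c<m)))
    where
    if-T : ∀ {b′} {x z : ℕ} → Bool.T b′ → (if b′ then x else z) ≡ x
    if-T {true} _ = ≡.refl

module _ (n : ℕ) {a : ℕ} (ks : Vec ℕ a) where
  open import Data.Nat using (_+_; _*_; _≡ᵇ_; s≤s; z≤n)
  open import Data.Nat.Solver using (module +-*-Solver)
  open +-*-Solver using (solve; _:=_; con; _:+_; _:*_)

  leafDelays : ℕ → ℕ
  leafDelays i = ℕ∑.∑ (λ j → leafDelay n i (lookup ks j)) (allFin a)

  leavesAt : ℕ → ℕ
  leavesAt m = ℕ∑.∑ (λ j → if m ≡ᵇ lookup ks j then 1 else 0) (allFin a)

  spinePotential : ℕ → ℕ
  spinePotential i = pathPotential n i + 2 * leafDelays i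

  treePotential : Fin n ⊎ Fin a → ℕ
  treePotential (inj₁ i) = spinePotential (suc (toℕ i))
  treePotential (inj₂ j) = suc (spinePotential (lookup ks j))

  spinePotential-last : spinePotential n ≡ 0
  spinePotential-last = ≡.cong₂ (λ p d → p + 2 * d) (pathPotential-last n)
    (≡.trans (ℕ∑.∑-cong (allFin a) (λ j → leafDelay-last n (lookup ks j))) (ℕ∑.∑-zero (allFin a) (λ _ → ≡.refl)))

  leafDelays-first : 2 ≤ n → (∀ j → 1 ≤ lookup ks j) → leafDelays 2 + leavesAt 1 ≡ leafDelays 1
  leafDelays-first 2≤n 1≤k = ≡.trans (≡.sym (ℕ∑.∑-distrib-+ _ _ (allFin a)))
    (ℕ∑.∑-cong (allFin a) (λ j → leafDelay-first 2≤n (1≤k j)))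

  leafDelays-step : ∀ i → suc (suc i) ≤ n →
    leafDelays (suc (suc i)) + leafDelays i + leavesAt (suc i) ≡ 2 * leafDelays (suc i)
  leafDelays-step i 2+i≤n = begin
    leafDelays (suc (suc i)) + leafDelays i + leavesAt (suc i)
      ≡⟨ ≡.cong (_+ leavesAt (suc i)) (ℕ∑.∑-distrib-+ _ _ (allFin a)) ⟨
    ℕ∑.∑ (λ j → leafDelay n (suc (suc i)) (lookup ks j) + leafDelay n i (lookup ks j)) (allFin a) + leavesAt (suc i)
      ≡⟨ ℕ∑.∑-distrib-+ _ _ (allFin a) ⟨
    ℕ∑.∑ (λ j → leafDelay n (suc (suc i)) (lookup ks j) + leafDelay n i (lookup ks j)
                + (if suc i ≡ᵇ lookup ks j then 1 else 0)) (allFin a)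
      ≡⟨ ℕ∑.∑-cong (allFin a) (λ j → leafDelay-step i (lookup ks j) 2+i≤n) ⟩
    ℕ∑.∑ (λ j → 2 * leafDelay n (suc i) (lookup ks j)) (allFin a)
      ≡⟨ ℕ∑.*-distribˡ-∑ 2 _ (allFin a) ⟨
    2 * leafDelays (suc i)
      ∎
    where open ≡.≡-Reasoning

  spinePotential-first : 2 ≤ n → (∀ j → 1 ≤ lookup ks j) →
    spinePotential 2 + 1 + 2 * leavesAt 1 ≡ spinePotential 1
  spinePotential-first 2≤n 1≤k = begin
    (P₂ + 2 * D₂) + 1 + 2 * c    ≡⟨ solve 3 (λ P₂ D₂ c → (P₂ :+ con 2 :* D₂) :+ con 1 :+ con 2 :* c
                                              := (P₂ :+ con 1) :+ con 2 :* (D₂ :+ c)) ≡.refl P₂ D₂ c ⟩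
    (P₂ + 1) + 2 * (D₂ + c)      ≡⟨ ≡.cong₂ (λ p d → p + 2 * d) (pathPotential-first 2≤n) (leafDelays-first 2≤n 1≤k) ⟩
    spinePotential 1             ∎
    where
    open ≡.≡-Reasoning
    P₂ = pathPotential n 2
    D₂ = leafDelays 2
    c  = leavesAt 1

  spinePotential-step : ∀ i → suc (suc i) ≤ n →
    spinePotential (suc (suc i)) + spinePotential i + 2 + 2 * leavesAt (suc i) ≡ 2 * spinePotential (suc i)
  spinePotential-step i 2+i≤n = begin
    (P₂ + 2 * D₂) + (P₀ + 2 * D₀) + 2 + 2 * c
      ≡⟨ solve 5 (λ P₂ P₀ D₂ D₀ c → (P₂ :+ con 2 :* D₂) :+ (P₀ :+ con 2 :* D₀) :+ con 2 :+ con 2 :* c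
                                    := (P₂ :+ P₀ :+ con 2) :+ con 2 :* (D₂ :+ D₀ :+ c)) ≡.refl P₂ P₀ D₂ D₀ c ⟩
    (P₂ + P₀ + 2) + 2 * (D₂ + D₀ + c)
      ≡⟨ ≡.cong₂ (λ p d → p + 2 * d) (pathPotential-step i 2+i≤n) (leafDelays-step i 2+i≤n) ⟩
    2 * P₁ + 2 * (2 * D₁)
      ≡⟨ solve 2 (λ P₁ D₁ → con 2 :* P₁ :+ con 2 :* (con 2 :* D₁) := con 2 :* (P₁ :+ con 2 :* D₁)) ≡.refl P₁ D₁ ⟩
    2 * spinePotential (suc i)
      ∎
    where
    open ≡.≡-Reasoning
    P₂ = pathPotential n (suc (suc i))
    P₁ = pathPotential n (suc i)
    P₀ = pathPotential n i
    D₂ = leafDelays (suc (suc i))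
    D₁ = leafDelays (suc i)
    D₀ = leafDelays i
    c  = leavesAt (suc i)

  -- The term of v_p, the spine neighbour below v_(p+1); v_1 has none.
  belowSpine : (ℕ → ℕ) → ℕ → ℕ
  belowSpine F zero    = 0
  belowSpine F (suc q) = F (suc q)

  private
    Tree = T n a ks
    Vertex = Fin n ⊎ Fin a

  ∑-vertices : ∀ (f : Vertex → ℕ) →
               ℕ∑.∑ f (vertices Tree) ≡ ℕ∑.∑ (f ∘ inj₁) (allFin n) + ℕ∑.∑ (f ∘ inj₂) (allFin a)
  ∑-vertices f = ≡.trans (ℕ∑.∑-++ f (map inj₁ (allFin n)) (map inj₂ (allFin a)))
                         (≡.cong₂ _+_ (ℕ∑.∑-map f inj₁ (allFin n)) (ℕ∑.∑-map f inj₂ (allFin a)))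

  ∑-nbrs : ∀ x (f : Vertex → ℕ) →
           ℕ∑.∑ f (nbrs Tree x) ≡ ℕ∑.∑ (λ y → if treeAdj ks x y then f y else 0) (vertices Tree)
  ∑-nbrs x f = ℕ∑.∑-filter (treeAdj ks x) f (vertices Tree)

  ∑-leavesAt : ∀ m (g : Fin a → ℕ) {L} → (∀ j → m ≡ lookup ks j → g j ≡ L) →
               ℕ∑.∑ (λ j → if m ≡ᵇ lookup ks j then g j else 0) (allFin a) ≡ leavesAt m * L
  ∑-leavesAt m g {L} g≡L = ≡.trans (ℕ∑.∑-cong (allFin a) term) (≡.sym (ℕ∑.*-distribʳ-∑ L _ (allFin a)))
    where
    term : ∀ j → (if m ≡ᵇ lookup ks j then g j else 0) ≡ (if m ≡ᵇ lookup ks j then 1 else 0) * L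
    term j with m ≡ᵇ lookup ks j in eq
    ... | false = ≡.refl
    ... | true  = ≡.trans (g≡L j (ℕP.≡ᵇ⇒≡ m (lookup ks j) (≡.subst Bool.T (≡.sym eq) _))) (≡.sym (ℕP.+-identityʳ L))

  ∑-spine-pick : ∀ (f : Vertex → ℕ) (F : ℕ → ℕ) (b : ℕ → Bool) {c} → c < n →
                 (∀ k → Bool.T (b k) → k ≡ c) → Bool.T (b c) → (∀ i → f (inj₁ i) ≡ F (suc (toℕ i))) →
                 ℕ∑.∑ (λ i → if b (toℕ i) then f (inj₁ i) else 0) (allFin n) ≡ F (suc c)
  ∑-spine-pick f F b c<n only-c b-c f≡F =
    ∑-allFin-pick b (f ∘ inj₁) c<n only-c b-c (λ i i≡c → ≡.trans (f≡F i) (≡.cong (F ∘ suc) i≡c))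

  ∑-nbrs-leaf : ∀ j (f : Vertex → ℕ) (F : ℕ → ℕ) → 1 ≤ lookup ks j → lookup ks j ≤ n →
                (∀ i → f (inj₁ i) ≡ F (suc (toℕ i))) → ℕ∑.∑ f (nbrs Tree (inj₂ j)) ≡ F (lookup ks j)
  ∑-nbrs-leaf j f F 1≤k k≤n f≡F = begin
    ℕ∑.∑ f (nbrs Tree (inj₂ j))
      ≡⟨ ≡.trans (∑-nbrs (inj₂ j) f) (∑-vertices _) ⟩
    ℕ∑.∑ (λ i → if suc (toℕ i) ≡ᵇ lookup ks j then f (inj₁ i) else 0) (allFin n) + ℕ∑.∑ (λ _ → 0) (allFin a)
      ≡⟨ ≡.cong₂ _+_ (spine (lookup ks j) 1≤k k≤n) (ℕ∑.∑-zero (allFin a) (λ _ → ≡.refl)) ⟩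
    F (lookup ks j) + 0
      ≡⟨ ℕP.+-identityʳ _ ⟩
    F (lookup ks j)
      ∎
    where
    open ≡.≡-Reasoning
    spine : ∀ k → 1 ≤ k → k ≤ n → ℕ∑.∑ (λ i → if suc (toℕ i) ≡ᵇ k then f (inj₁ i) else 0) (allFin n) ≡ F k
    spine (suc c) _ c<n = ∑-spine-pick f F (λ m → suc m ≡ᵇ suc c) c<n
      (λ m → ℕP.≡ᵇ⇒≡ m c) (ℕP.≡⇒≡ᵇ c c ≡.refl) f≡F

  ∑-nbrs-spine : ∀ i (f : Vertex → ℕ) (F : ℕ → ℕ) {L} → suc (suc (toℕ i)) ≤ n →
    (∀ j → f (inj₁ j) ≡ F (suc (toℕ j))) → (∀ j → suc (toℕ i) ≡ lookup ks j → f (inj₂ j) ≡ L) →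
    ℕ∑.∑ f (nbrs Tree (inj₁ i)) ≡ F (suc (suc (toℕ i))) + belowSpine F (toℕ i) + leavesAt (suc (toℕ i)) * L
  ∑-nbrs-spine i f F {L} 2+p≤n f≡F f≡L = begin
    ℕ∑.∑ f (nbrs Tree (inj₁ i))
      ≡⟨ ≡.trans (∑-nbrs (inj₁ i) f) (∑-vertices _) ⟩
    ℕ∑.∑ (λ j → if above j ∨ below j then f (inj₁ j) else 0) (allFin n) + leafPart
      ≡⟨ ≡.cong (_+ leafPart) (ℕ∑.∑-cong (allFin n) (λ j → if-∨ (above j) (below j) (f (inj₁ j)) (disjoint j))) ⟩
    ℕ∑.∑ (λ j → (if above j then f (inj₁ j) else 0) + (if below j then f (inj₁ j) else 0)) (allFin n) + leafPart
      ≡⟨ ≡.cong (_+ leafPart) (ℕ∑.∑-distrib-+ _ _ (allFin n)) ⟩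
    ℕ∑.∑ (λ j → if above j then f (inj₁ j) else 0) (allFin n)
      + ℕ∑.∑ (λ j → if below j then f (inj₁ j) else 0) (allFin n) + leafPart
      ≡⟨ ≡.cong₂ _+_ (≡.cong₂ _+_
           (∑-spine-pick f F (suc p ≡ᵇ_) 2+p≤n (λ m t → ≡.sym (ℕP.≡ᵇ⇒≡ (suc p) m t)) (ℕP.≡⇒≡ᵇ (suc p) (suc p) ≡.refl) f≡F)
           (∑-below p (ℕP.<-trans (ℕP.n<1+n p) 2+p≤n)))
           (∑-leavesAt (suc p) (f ∘ inj₂) f≡L) ⟩
    F (suc (suc p)) + belowSpine F p + leavesAt (suc p) * L
      ∎
    where
    open ≡.≡-Reasoning
    p = toℕ i
    above below : Fin n → Bool
    above j = suc p ≡ᵇ toℕ j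
    below j = suc (toℕ j) ≡ᵇ p
    leafPart = ℕ∑.∑ (λ j → if suc p ≡ᵇ lookup ks j then f (inj₂ j) else 0) (allFin a)
    disjoint : ∀ j → Bool.T (above j) → Bool.T (below j) → ⊥
    disjoint j t₁ t₂ = ℕP.m≢1+n+m p
      (≡.trans (≡.sym (ℕP.≡ᵇ⇒≡ (suc (toℕ j)) p t₂)) (≡.cong suc (≡.sym (ℕP.≡ᵇ⇒≡ (suc p) (toℕ j) t₁))))
    ∑-below : ∀ q → q < n → ℕ∑.∑ (λ j → if suc (toℕ j) ≡ᵇ q then f (inj₁ j) else 0) (allFin n) ≡ belowSpine F q
    ∑-below zero    _     = ℕ∑.∑-zero (allFin n) (λ _ → ≡.refl)
    ∑-below (suc q) 1+q<n = ∑-spine-pick f F (λ m → suc m ≡ᵇ suc q) (ℕP.<-trans (ℕP.n<1+n q) 1+q<n)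
      (λ m → ℕP.≡ᵇ⇒≡ m q) (ℕP.≡⇒≡ᵇ q q ≡.refl) f≡F

  spine-balance : ∀ p → suc (suc p) ≤ n → (∀ j → 1 ≤ lookup ks j) →
    let M = spinePotential (suc p); c = leavesAt (suc p) in
    M + belowSpine (λ _ → M) p + c * M ≡ suc (spinePotential (suc (suc p))) + belowSpine (suc ∘ spinePotential) p + c * suc (suc M)
  spine-balance zero 2≤n 1≤k = begin
    M + 0 + c * M                        ≡⟨ ≡.cong (λ z → z + 0 + c * M) (spinePotential-first 2≤n 1≤k) ⟨
    (H₂ + 1 + 2 * c) + 0 + c * M         ≡⟨ solve 3 (λ H₂ c M → (H₂ :+ con 1 :+ con 2 :* c) :+ con 0 :+ c :* M
                                                      := con 1 :+ H₂ :+ con 0 :+ c :* (con 2 :+ M)) ≡.refl H₂ c M ⟩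
    suc H₂ + 0 + c * suc (suc M)         ∎
    where
    open ≡.≡-Reasoning
    M = spinePotential 1
    H₂ = spinePotential 2
    c = leavesAt 1
  spine-balance (suc q) 3+q≤n _ = begin
    M + M + c * M                        ≡⟨ solve 2 (λ M c → M :+ M :+ c :* M := con 2 :* M :+ c :* M) ≡.refl M c ⟩
    2 * M + c * M                        ≡⟨ ≡.cong (_+ c * M) (spinePotential-step (suc q) 3+q≤n) ⟨
    (H₃ + H₁ + 2 + 2 * c) + c * M        ≡⟨ solve 4 (λ H₃ H₁ c M → (H₃ :+ H₁ :+ con 2 :+ con 2 :* c) :+ c :* M
                                                      := con 1 :+ H₃ :+ (con 1 :+ H₁) :+ c :* (con 2 :+ M)) ≡.refl H₃ H₁ c M ⟩
    suc H₃ + suc H₁ + c * suc (suc M)    ∎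
    where
    open ≡.≡-Reasoning
    M = spinePotential (suc (suc q))
    H₃ = spinePotential (suc (suc (suc q)))
    H₁ = spinePotential (suc q)
    c = leavesAt (suc (suc q))

  treeAdj-sym : ∀ (x y : Vertex) → treeAdj ks x y ≡ treeAdj ks y x
  treeAdj-sym (inj₁ i) (inj₁ j) = BoolP.∨-comm (suc (toℕ i) ≡ᵇ toℕ j) (suc (toℕ j) ≡ᵇ toℕ i)
  treeAdj-sym (inj₁ i) (inj₂ j) = ≡.refl
  treeAdj-sym (inj₂ i) (inj₁ j) = ≡.refl
  treeAdj-sym (inj₂ i) (inj₂ j) = ≡.refl

  vertices-unique : Unique (vertices Tree)
  vertices-unique = Unique.++⁺ (Unique.map⁺ SumP.inj₁-injective (Unique.allFin⁺ n))
                               (Unique.map⁺ SumP.inj₂-injective (Unique.allFin⁺ a))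
                               spine-leaf-disjoint
    where
    spine-leaf-disjoint : ∀ {x} → ¬ (x ∈ map inj₁ (allFin n) × x ∈ map inj₂ (allFin a))
    spine-leaf-disjoint (x∈spine , x∈leaves) with ∈-map⁻ inj₁ x∈spine | ∈-map⁻ inj₂ x∈leaves
    ... | _ , _ , ≡.refl | _ , _ , ()

  module _ (1≤k : ∀ j → 1 ≤ lookup ks j) (k≤n : ∀ j → lookup ks j ≤ n)
           {w : Fin n} (w-last : suc (toℕ w) ≡ n) where

    i≢w⇒2+i≤n : ∀ {i} → i ≢ w → suc (suc (toℕ i)) ≤ n
    i≢w⇒2+i≤n {i} i≢w = ℕP.≤∧≢⇒< (FinP.toℕ<n i)
      (λ 1+i≡n → i≢w (FinP.toℕ-injective (ℕP.suc-injective (≡.trans 1+i≡n (≡.sym w-last)))))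

    treePotential-isHittingPotential : HittingPotential Tree (inj₁ w) treePotential
    treePotential-isHittingPotential = record
      { at-target   = ≡.trans (≡.cong spinePotential w-last) spinePotential-last
      ; deg-nonZero = deg-nonZero
      ; mean-value  = λ {x} x≢w → mean-value-from-∑ Tree treePotential x (balance x x≢w)
      }
      where
      spine-nonTarget : ∀ {i} → inj₁ i ≢ inj₁ w → suc (suc (toℕ i)) ≤ n
      spine-nonTarget i≢w = i≢w⇒2+i≤n (i≢w ∘ ≡.cong inj₁)
      deg-nonZero : ∀ {x} → x ≢ inj₁ w → NonZero (deg Tree x)
      deg-nonZero {inj₁ i} i≢w = ≡.subst NonZero (≡.sym (≡.trans (deg≡∑1 Tree (inj₁ i))
        (∑-nbrs-spine i (λ _ → 1) (λ _ → 1) {1} (spine-nonTarget i≢w) (λ _ → ≡.refl) (λ _ _ → ≡.refl)))) _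
      deg-nonZero {inj₂ j} _   = ≡.subst NonZero (≡.sym (≡.trans (deg≡∑1 Tree (inj₂ j))
        (∑-nbrs-leaf j (λ _ → 1) (λ _ → 1) (1≤k j) (k≤n j) (λ _ → ≡.refl)))) _
      balance : ∀ x → x ≢ inj₁ w →
        ℕ∑.∑ (λ _ → treePotential x) (nbrs Tree x) ≡ ℕ∑.∑ (suc ∘ treePotential) (nbrs Tree x)
      balance (inj₁ i) i≢w = begin
        ℕ∑.∑ (λ _ → M) (nbrs Tree (inj₁ i))
          ≡⟨ ∑-nbrs-spine i (λ _ → M) (λ _ → M) 2+i≤n (λ _ → ≡.refl) (λ _ _ → ≡.refl) ⟩
        M + belowSpine (λ _ → M) (toℕ i) + leavesAt (suc (toℕ i)) * M
          ≡⟨ spine-balance (toℕ i) 2+i≤n 1≤k ⟩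
        suc (spinePotential (suc (suc (toℕ i)))) + belowSpine (suc ∘ spinePotential) (toℕ i)
          + leavesAt (suc (toℕ i)) * suc (suc M)
          ≡⟨ ∑-nbrs-spine i (suc ∘ treePotential) (suc ∘ spinePotential) 2+i≤n (λ _ → ≡.refl)
               (λ j i≡k → ≡.cong (suc ∘ suc ∘ spinePotential) (≡.sym i≡k)) ⟨
        ℕ∑.∑ (suc ∘ treePotential) (nbrs Tree (inj₁ i))
          ∎
        where
        open ≡.≡-Reasoning
        M = spinePotential (suc (toℕ i))
        2+i≤n = spine-nonTarget i≢w
      balance (inj₂ j) _ = ≡.trans
        (∑-nbrs-leaf j (λ _ → treePotential (inj₂ j)) (λ _ → treePotential (inj₂ j)) (1≤k j) (k≤n j) (λ _ → ≡.refl))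
        (≡.sym (∑-nbrs-leaf j (suc ∘ treePotential) (suc ∘ spinePotential) (1≤k j) (k≤n j) (λ _ → ≡.refl)))

    tree-hittingTime : ∀ {i} → i ≢ w →
      HittingTime≡ Tree (inj₁ i) (inj₁ w) (ℕtoℚ (spinePotential (suc (toℕ i))))
    tree-hittingTime {i} i≢w = hittingTime≡potential Tree treeAdj-sym vertices-unique
      (∈-++⁺ˡ (∈-map⁺ inj₁ (∈-allFin i))) (i≢w ∘ SumP.inj₁-injective) treePotential-isHittingPotential

pos-∸ : ∀ {m n} → n ℕ.≤ m → + (m ℕ.∸ n) ≡ + m ℤ.- + n
pos-∸ {m} {n} n≤m = ≡.trans (≡.sym (ℤP.⊖-≥ n≤m)) (≡.sym (ℤP.[+m]-[+n]≡m⊖n m n))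

pos-∑∸ : ∀ n (ks : List ℕ) → All (ℕ._≤ n) ks →
         + ℕ∑.∑ (n ℕ.∸_) ks ≡ + length ks ℤ.* + n ℤ.- + sumℕ ks
pos-∑∸ n []       All.[]             = ≡.refl
pos-∑∸ n (k ∷ ks) (k≤n All.∷ ks≤n) = begin
  + ((n ℕ.∸ k) ℕ.+ ℕ∑.∑ (n ℕ.∸_) ks)              ≡⟨ ℤP.pos-+ (n ℕ.∸ k) _ ⟩
  + (n ℕ.∸ k) ℤ.+ + ℕ∑.∑ (n ℕ.∸_) ks              ≡⟨ ≡.cong₂ ℤ._+_ (pos-∸ k≤n) (pos-∑∸ n ks ks≤n) ⟩
  (+ n ℤ.- + k) ℤ.+ (+ length ks ℤ.* + n ℤ.- + sumℕ ks)
    ≡⟨ solve 4 (λ N K L S → (N :- K) :+ (L :* N :- S) := (con (+ 1) :+ L) :* N :- (K :+ S)) ≡.refl (+ n) (+ k) (+ length ks) (+ sumℕ ks) ⟩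
  (+ 1 ℤ.+ + length ks) ℤ.* + n ℤ.- (+ k ℤ.+ + sumℕ ks)
    ≡⟨ ≡.cong₂ (λ L S → L ℤ.* + n ℤ.- S) (ℤP.pos-+ 1 (length ks)) (ℤP.pos-+ k (sumℕ ks)) ⟨
  + length (k ∷ ks) ℤ.* + n ℤ.- + sumℕ (k ∷ ks)    ∎
  where
  open ≡.≡-Reasoning
  open ℤSolver.+-*-Solver using (solve; _:=_; con; _:+_; _:*_; _:-_)

∑-allFin-lookup : ∀ {a} (ks : Vec ℕ a) (f : ℕ → ℕ) → ℕ∑.∑ (f ∘ lookup ks) (allFin a) ≡ ℕ∑.∑ f (toList ks)
∑-allFin-lookup []       f = ≡.refl
∑-allFin-lookup {suc a} (k ∷ ks) f = ≡.cong (f k ℕ.+_) (begin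
  ℕ∑.∑ (f ∘ lookup (k ∷ ks)) (List.tabulate Fin.suc)    ≡⟨ ≡.cong (ℕ∑.∑ (f ∘ lookup (k ∷ ks))) (ListP.map-tabulate id Fin.suc) ⟨
  ℕ∑.∑ (f ∘ lookup (k ∷ ks)) (map Fin.suc (allFin a))   ≡⟨ ℕ∑.∑-map (f ∘ lookup (k ∷ ks)) Fin.suc (allFin a) ⟩
  ℕ∑.∑ (f ∘ lookup ks) (allFin a)                       ≡⟨ ∑-allFin-lookup ks f ⟩
  ℕ∑.∑ f (toList ks)                                    ∎)
  where open ≡.≡-Reasoning

module _ (n : ℕ) {a : ℕ} (ks : Vec ℕ a) where
  open import Data.Nat using (_+_; _*_)
  open import Data.List using (take; drop)

  private
    l = toList ks

  leafDelays-split : ∀ s i → s ≤ a → All (_≤ i) (take s l) → All (i ≤_) (drop s l) →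
                     leafDelays n ks i ≡ s * (n ∸ i) + ℕ∑.∑ (n ∸_) (drop s l)
  leafDelays-split s i s≤a take≤i i≤drop = begin
    leafDelays n ks i
      ≡⟨ ∑-allFin-lookup ks (leafDelay n i) ⟩
    ℕ∑.∑ (leafDelay n i) l
      ≡⟨ ≡.cong (ℕ∑.∑ (leafDelay n i)) (ListP.take++drop≡id s l) ⟨
    ℕ∑.∑ (leafDelay n i) (take s l ++ drop s l)
      ≡⟨ ℕ∑.∑-++ (leafDelay n i) (take s l) (drop s l) ⟩
    ℕ∑.∑ (leafDelay n i) (take s l) + ℕ∑.∑ (leafDelay n i) (drop s l)
      ≡⟨ ≡.cong₂ _+_ (ℕ∑.∑-cong-∈ (take s l) (λ k∈ → ≡.cong (n ∸_) (ℕP.m≥n⇒m⊔n≡m (All.lookup take≤i k∈))))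
                     (ℕ∑.∑-cong-∈ (drop s l) (λ k∈ → ≡.cong (n ∸_) (ℕP.m≤n⇒m⊔n≡n (All.lookup i≤drop k∈)))) ⟩
    ℕ∑.∑ (λ _ → n ∸ i) (take s l) + ℕ∑.∑ (n ∸_) (drop s l)
      ≡⟨ ≡.cong (_+ ℕ∑.∑ (n ∸_) (drop s l)) (ℕ∑-const (n ∸ i) (take s l)) ⟩
    length (take s l) * (n ∸ i) + ℕ∑.∑ (n ∸_) (drop s l)
      ≡⟨ ≡.cong (λ m → m * (n ∸ i) + ℕ∑.∑ (n ∸_) (drop s l)) length-take ⟩
    s * (n ∸ i) + ℕ∑.∑ (n ∸_) (drop s l)
      ∎
    where
    open ≡.≡-Reasoning
    length-take : length (take s l) ≡ s
    length-take = ≡.trans (ListP.length-take s l)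
      (≡.trans (≡.cong (s ℕ.⊓_) (VecP.length-toList ks)) (ℕP.m≤n⇒m⊓n≡m s≤a))

  spinePotential≡formula₁ : ∀ s i → s ≤ a → 1 ≤ i → i ≤ n → All (_≤ n) (drop s l) →
    All (_≤ i) (take s l) → All (i ≤_) (drop s l) → ℕtoℚ (spinePotential n ks i) ≡ formula₁ n ks s i
  spinePotential≡formula₁ s i s≤a 1≤i i≤n drop≤n take≤i i≤drop = ≡.cong toℚ (begin
    + (pathPotential n i + 2 * leafDelays n ks i)
      ≡⟨ ≡.trans (ℤP.pos-+ (pathPotential n i) (2 * leafDelays n ks i)) (≡.cong (ℤ._+_ (+ pathPotential n i)) (ℤP.pos-* 2 (leafDelays n ks i))) ⟩
    + pathPotential n i ℤ.+ + 2 ℤ.* + leafDelays n ks i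
      ≡⟨ ≡.cong₂ (λ P D → P ℤ.+ + 2 ℤ.* D) path delays ⟩
    (+ n ℤ.- + i) ℤ.* (+ n ℤ.+ + i ℤ.- + 2) ℤ.+ + 2 ℤ.* (+ s ℤ.* (+ n ℤ.- + i) ℤ.+ ((+ a ℤ.- + s) ℤ.* + n ℤ.- + sumFrom ks s))
      ≡⟨ solve 5 (λ N I A S Σ → (N :- I) :* (N :+ I :- con (+ 2)) :+ con (+ 2) :* (S :* (N :- I) :+ ((A :- S) :* N :- Σ))
                             := N :* N :- I :* I :+ con (+ 2) :* (A :- con (+ 1)) :* N
                                :- con (+ 2) :* (S :- con (+ 1)) :* I :- con (+ 2) :* Σ)
                 ≡.refl (+ n) (+ i) (+ a) (+ s) (+ sumFrom ks s) ⟩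
    + n ℤ.* + n ℤ.- + i ℤ.* + i ℤ.+ + 2 ℤ.* (+ a ℤ.- + 1) ℤ.* + n
      ℤ.- + 2 ℤ.* (+ s ℤ.- + 1) ℤ.* + i ℤ.- + 2 ℤ.* + sumFrom ks s
      ≡⟨ ≡.cong₂ (λ N² I² → N² ℤ.- I² ℤ.+ + 2 ℤ.* (+ a ℤ.- + 1) ℤ.* + n ℤ.- + 2 ℤ.* (+ s ℤ.- + 1) ℤ.* + i ℤ.- + 2 ℤ.* + sumFrom ks s)
                   (ℤP.pos-* n n) (ℤP.pos-* i i) ⟨
    + (n * n) ℤ.- + (i * i) ℤ.+ + 2 ℤ.* (+ a ℤ.- + 1) ℤ.* + n
      ℤ.- + 2 ℤ.* (+ s ℤ.- + 1) ℤ.* + i ℤ.- + 2 ℤ.* + sumFrom ks s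
      ∎)
    where
    open ≡.≡-Reasoning
    open ℤSolver.+-*-Solver using (solve; _:=_; con; _:+_; _:*_; _:-_)
    path : + pathPotential n i ≡ (+ n ℤ.- + i) ℤ.* (+ n ℤ.+ + i ℤ.- + 2)
    path = ≡.trans (ℤP.pos-* (n ∸ i) (n + i ∸ 2)) (≡.cong₂ ℤ._*_ (pos-∸ i≤n)
      (≡.trans (pos-∸ (ℕP.+-mono-≤ (ℕP.≤-trans 1≤i i≤n) 1≤i)) (≡.cong (ℤ._- + 2) (ℤP.pos-+ n i))))
    delays : + leafDelays n ks i ≡ + s ℤ.* (+ n ℤ.- + i) ℤ.+ ((+ a ℤ.- + s) ℤ.* + n ℤ.- + sumFrom ks s)
    delays = begin
      + leafDelays n ks i
        ≡⟨ ≡.cong +_ (leafDelays-split s i s≤a take≤i i≤drop) ⟩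
      + (s * (n ∸ i) + ℕ∑.∑ (n ∸_) (drop s l))
        ≡⟨ ≡.trans (ℤP.pos-+ (s * (n ∸ i)) _) (≡.cong₂ ℤ._+_ (≡.trans (ℤP.pos-* s (n ∸ i)) (≡.cong (+ s ℤ.*_) (pos-∸ i≤n)))
                                                   (pos-∑∸ n (drop s l) drop≤n)) ⟩
      + s ℤ.* (+ n ℤ.- + i) ℤ.+ (+ length (drop s l) ℤ.* + n ℤ.- + sumFrom ks s)
        ≡⟨ ≡.cong (λ L → + s ℤ.* (+ n ℤ.- + i) ℤ.+ (L ℤ.* + n ℤ.- + sumFrom ks s)) length-drop ⟩
      + s ℤ.* (+ n ℤ.- + i) ℤ.+ ((+ a ℤ.- + s) ℤ.* + n ℤ.- + sumFrom ks s)
        ∎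
      where
      length-drop : + length (drop s l) ≡ + a ℤ.- + s
      length-drop = ≡.trans (≡.cong +_ (≡.trans (ListP.length-drop s l) (≡.cong (_∸ s) (VecP.length-toList ks))))
                            (pos-∸ s≤a)

formula₁≡formula₂ : ∀ n {a} (ks : Vec ℕ a) i → sumFrom ks a ≡ 0 → formula₁ n ks a i ≡ formula₂ a n i
formula₁≡formula₂ n {a} ks i Σ≡0 = ≡.cong toℚ (begin
  N² ℤ.- I² ℤ.+ + 2 ℤ.* (+ a ℤ.- + 1) ℤ.* + n ℤ.- + 2 ℤ.* (+ a ℤ.- + 1) ℤ.* + i ℤ.- + 2 ℤ.* + sumFrom ks a
    ≡⟨ ≡.cong (λ Σ → N² ℤ.- I² ℤ.+ + 2 ℤ.* (+ a ℤ.- + 1) ℤ.* + n ℤ.- + 2 ℤ.* (+ a ℤ.- + 1) ℤ.* + i ℤ.- + 2 ℤ.* + Σ) Σ≡0 ⟩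
  N² ℤ.- I² ℤ.+ + 2 ℤ.* (+ a ℤ.- + 1) ℤ.* + n ℤ.- + 2 ℤ.* (+ a ℤ.- + 1) ℤ.* + i ℤ.- + 2 ℤ.* + 0
    ≡⟨ solve 5 (λ N² I² A N I → N² :- I² :+ con (+ 2) :* (A :- con (+ 1)) :* N :- con (+ 2) :* (A :- con (+ 1)) :* I
                                  :- con (+ 2) :* con (+ 0)
                              := N² :- I² :+ con (+ 2) :* (A :- con (+ 1)) :* (N :- I)) ≡.refl N² I² (+ a) (+ n) (+ i) ⟩
  N² ℤ.- I² ℤ.+ + 2 ℤ.* (+ a ℤ.- + 1) ℤ.* (+ n ℤ.- + i)
    ∎)
  where
  open ≡.≡-Reasoning
  open ℤSolver.+-*-Solver using (solve; _:=_; con; _:+_; _:*_; _:-_)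
  N² = + (n ℕ.* n)
  I² = + (i ℕ.* i)

lookup≡lookupℕ : ∀ {a} (ks : Vec ℕ a) j → lookup ks j ≡ lookupℕ (toList ks) (toℕ j)
lookup≡lookupℕ (k ∷ ks) Fin.zero    = ≡.refl
lookup≡lookupℕ (k ∷ ks) (Fin.suc j) = lookup≡lookupℕ ks j

module _ {P : ℕ → Set} where
  open import Data.List using (take; drop)

  All-drop-lookupℕ : ∀ (ks : List ℕ) s → (∀ x → s ℕ.≤ x → x ℕ.< length ks → P (lookupℕ ks x)) → All P (drop s ks)
  All-drop-lookupℕ []       zero    _ = All.[]
  All-drop-lookupℕ []       (suc s) _ = All.[]
  All-drop-lookupℕ (k ∷ ks) zero    p = p 0 ℕ.z≤n (ℕ.s≤s ℕ.z≤n) All.∷ All-drop-lookupℕ ks 0 (λ x _ x< → p (suc x) ℕ.z≤n (ℕ.s≤s x<))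
  All-drop-lookupℕ (k ∷ ks) (suc s) p = All-drop-lookupℕ ks s (λ x s≤x x< → p (suc x) (ℕ.s≤s s≤x) (ℕ.s≤s x<))

  All-take-lookupℕ : ∀ (ks : List ℕ) s → (∀ x → x ℕ.< s → P (lookupℕ ks x)) → All P (take s ks)
  All-take-lookupℕ ks       zero    _ = All.[]
  All-take-lookupℕ []       (suc s) _ = All.[]
  All-take-lookupℕ (k ∷ ks) (suc s) p = p 0 (ℕ.s≤s ℕ.z≤n) All.∷ All-take-lookupℕ ks s (λ x x<s → p (suc x) (ℕ.s≤s x<s))

lookupℕ-mono : ∀ {a} (ks : Vec ℕ a) → (∀ (p q : Fin a) → p Fin.< q → lookup ks p ℕ.< lookup ks q) →
               ∀ {x y} → x ℕ.≤ y → y ℕ.< a → lookupℕ (toList ks) x ℕ.≤ lookupℕ (toList ks) y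
lookupℕ-mono ks sorted {x} {y} x≤y y<a with ℕP.m≤n⇒m<n∨m≡n x≤y
... | inj₂ ≡.refl = ℕP.≤-refl
... | inj₁ x<y    = ℕP.<⇒≤ (≡.subst₂ ℕ._<_ (lookup-at x<a) (lookup-at y<a) (sorted (Fin.fromℕ< x<a) (Fin.fromℕ< y<a) fromℕ<-mono))
  where
  x<a = ℕP.<-trans x<y y<a
  lookup-at : ∀ {z} (z<a : z ℕ.< _) → lookup ks (Fin.fromℕ< z<a) ≡ lookupℕ (toList ks) z
  lookup-at z<a = ≡.trans (lookup≡lookupℕ ks _) (≡.cong (lookupℕ (toList ks)) (FinP.toℕ-fromℕ< z<a))
  fromℕ<-mono : Fin.fromℕ< x<a Fin.< Fin.fromℕ< y<a
  fromℕ<-mono = ≡.subst₂ ℕ._<_ (≡.sym (FinP.toℕ-fromℕ< x<a)) (≡.sym (FinP.toℕ-fromℕ< y<a)) x<y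

module _ {n a′ : ℕ} (ks : Vec ℕ (suc a′))
         (sorted : ∀ (p q : Fin (suc a′)) → p Fin.< q → lookup ks p < lookup ks q)
         (1<k₁ : 1 < kAt ks 1) (kₐ<n : kAt ks (suc a′) < n)
         {w : Fin n} (w-last : suc (toℕ w) ≡ n) where

  private
    a = suc a′
    l = toList ks
    mono = lookupℕ-mono ks sorted
    length-l : length l ≡ a
    length-l = VecP.length-toList ks

  lookupℕ-bounds : ∀ x → x < a → 2 ≤ lookupℕ l x × lookupℕ l x < n
  lookupℕ-bounds x x<a = ℕP.≤-trans 1<k₁ (mono ℕ.z≤n x<a) , ℕP.≤-<-trans (mono (ℕ.s≤s⁻¹ x<a) (ℕP.n<1+n a′)) kₐ<n

  1≤lookup : ∀ j → 1 ≤ lookup ks j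
  1≤lookup j rewrite lookup≡lookupℕ ks j = ℕP.≤-trans (ℕ.s≤s ℕ.z≤n) (proj₁ (lookupℕ-bounds (toℕ j) (FinP.toℕ<n j)))

  lookup≤n : ∀ j → lookup ks j ≤ n
  lookup≤n j rewrite lookup≡lookupℕ ks j = ℕP.<⇒≤ (proj₂ (lookupℕ-bounds (toℕ j) (FinP.toℕ<n j)))

  drop≤n : ∀ s → All (_≤ n) (List.drop s l)
  drop≤n s = All-drop-lookupℕ l s (λ x _ x<len → ℕP.<⇒≤ (proj₂ (lookupℕ-bounds x (≡.subst (x <_) length-l x<len))))

  take≤kAt : ∀ s {i} → s ≤ a → kAt ks s ≤ i → All (_≤ i) (List.take s l)
  take≤kAt zero    _     _    = All.[]
  take≤kAt (suc s) 1+s≤a kₛ≤i = All-take-lookupℕ l (suc s) (λ x x<1+s → ℕP.≤-trans (mono (ℕ.s≤s⁻¹ x<1+s) 1+s≤a) kₛ≤i)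

  kAt≤drop : ∀ s {i} → i ≤ kAt ks (suc s) → All (i ≤_) (List.drop s l)
  kAt≤drop s i≤kₛ = All-drop-lookupℕ l s (λ x s≤x x<len → ℕP.≤-trans i≤kₛ (mono s≤x (≡.subst (x <_) length-l x<len)))

  1+i<n⇒i≢w : ∀ {i} → suc (toℕ i) < n → i ≢ w
  1+i<n⇒i≢w 1+i<n ≡.refl = ℕP.<-irrefl w-last 1+i<n

  hittingTime-before-last-leaf : ∀ s → s < a → (i : Fin n) → kAt ks s ≤ suc (toℕ i) → suc (toℕ i) ≤ kAt ks (suc s) →
    HittingTime≡ (T n a ks) (inj₁ i) (inj₁ w) (formula₁ n ks s (suc (toℕ i)))
  hittingTime-before-last-leaf s s<a i kₛ≤i i≤kₛ₊₁ = ≡.subst (HittingTime≡ (T n a ks) (inj₁ i) (inj₁ w))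
    (spinePotential≡formula₁ n ks s (suc (toℕ i)) (ℕP.<⇒≤ s<a) (ℕ.s≤s ℕ.z≤n) (FinP.toℕ<n i) (drop≤n s)
      (take≤kAt s (ℕP.<⇒≤ s<a) kₛ≤i) (kAt≤drop s i≤kₛ₊₁))
    (tree-hittingTime n ks 1≤lookup lookup≤n w-last (1+i<n⇒i≢w (ℕP.≤-<-trans i≤kₛ₊₁ (proj₂ (lookupℕ-bounds s s<a)))))

  hittingTime-after-last-leaf : ∀ (i : Fin n) → kAt ks a ≤ suc (toℕ i) → suc (toℕ i) ≤ n ∸ 1 →
    HittingTime≡ (T n a ks) (inj₁ i) (inj₁ w) (formula₂ a n (suc (toℕ i)))
  hittingTime-after-last-leaf i kₐ≤i i≤n-1 = ≡.subst (HittingTime≡ (T n a ks) (inj₁ i) (inj₁ w))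
    (≡.trans (spinePotential≡formula₁ n ks a (suc (toℕ i)) ℕP.≤-refl (ℕ.s≤s ℕ.z≤n) (FinP.toℕ<n i) (drop≤n a)
               (take≤kAt a ℕP.≤-refl kₐ≤i) (≡.subst (All _) (≡.sym drop-all) All.[]))
             (formula₁≡formula₂ n ks (suc (toℕ i)) (≡.cong sumℕ drop-all)))
    (tree-hittingTime n ks 1≤lookup lookup≤n w-last (1+i<n⇒i≢w (≤∸1⇒< (ℕP.≤-<-trans ℕ.z≤n kₐ<n) i≤n-1)))
    where
    drop-all : List.drop a l ≡ []
    drop-all = ListP.drop-all a l (ℕP.≤-reflexive length-l)
    ≤∸1⇒< : ∀ {m k} → 0 < k → m ≤ k ∸ 1 → m < k
    ≤∸1⇒< {k = suc k} _ m≤k = ℕ.s≤s m≤k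

theorem4 : (n a : ℕ) → (ks : Vec ℕ a) → 1 ≤ a
    → (∀ (p q : Fin a) → p Fin.< q → lookup ks p < lookup ks q)
    → 1 < kAt ks 1 → kAt ks a < n
    → (w : Fin n) → suc (toℕ w) ≡ n
    → (∀ (s : ℕ) → s < a → (i : Fin n)
         → kAt ks s ≤ suc (toℕ i) → suc (toℕ i) ≤ kAt ks (suc s)
         → HittingTime≡ (T n a ks) (inj₁ i) (inj₁ w) (formula₁ n ks s (suc (toℕ i))))
      × (∀ (i : Fin n) → kAt ks a ≤ suc (toℕ i) → suc (toℕ i) ≤ n ∸ 1
         → HittingTime≡ (T n a ks) (inj₁ i) (inj₁ w) (formula₂ a n (suc (toℕ i))))
theorem4 n (suc a′) ks (ℕ.s≤s ℕ.z≤n) sorted 1<k₁ kₐ<n w w-last =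
  hittingTime-before-last-leaf ks sorted 1<k₁ kₐ<n w-last , hittingTime-after-last-leaf ks sorted 1<k₁ kₐ<n w-last
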